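{- Let $H$ be a graph, $G$ a graph and $\sigma:V(G)\to V(H)$ an $H$-coloring of $G$. A set $X\subseteq V(G)$ hits all $\sigma$-$H$-subgraphs of $G$ if and only if there exists a connected component $C$ of $H$ such that, with $V_C=\sigma^{ -1}(C)\subseteq V(G)$, the set $X\cap V_C$ hits all $\sigma|_{V_C}$-$H[C]$-subgraphs of $G[V_C]$.
   Context: For a graph $F$ and a graph $G$ with a coloring $\sigma:V(G)\to V(F)$, a $\sigma$-$F$-subgraph of $G$ is an injective map $\pi:V(F)\to V(G)$ such that $ab\in E(F)$ implies $\pi(a)\pi(b)\in E(G)$ and $\sigma(\pi(a))=a$ for all $a\in V(F)$. A set $X$ hits $\pi$ if $X\cap\pi(V(F))\ne\emptyset$. -}

module Defs where

open import Data.Nat using (ℕ)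
open import Data.Fin using (Fin)
open import Data.Bool using (Bool; T)
open import Data.Product using (Σ; ∃; _,_; proj₁)
open import Relation.Nullary using (¬_; Dec)
open import Relation.Binary.PropositionalEquality using (_≡_)
open import Function.Bundles using (_↔_; _⇔_)
open import Function.Definitions using (Injective)

record Graph : Set₁ where
  field
    V       : Set
    E       : V → V → Set
    E-sym   : ∀ {a b} → E a b → E b a
    E-irr   : ∀ {a} → ¬ E a a
open Graph public

Finite : Set → Set
Finite A = Σ ℕ λ n → A ↔ Fin n

IsFinGraph : Graph → Set
IsFinGraph G = Finite (V G) × DecAdj
  where
  open import Data.Product using (_×_)
  DecAdj : Set
  DecAdj = ∀ a b → Dec (E G a b)

Subset : Set → Set
Subset A = A → Bool

Induced : (G : Graph) → Subset (V G) → Graph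
Induced G P = record
  { V     = Σ (V G) (λ v → T (P v))
  ; E     = λ u w → E G (proj₁ u) (proj₁ w)
  ; E-sym = E-sym G
  ; E-irr = E-irr G
  }

data Reach (G : Graph) : V G → V G → Set where
  here : ∀ {a} → Reach G a a
  step : ∀ {a b c} → E G a b → Reach G b c → Reach G a c

IsComponent : (H : Graph) → Subset (V H) → Set
IsComponent H C = ∃ λ c → ∀ a → (T (C a) ⇔ Reach H a c)

record σSub (F G : Graph) (σ : V G → V F) : Set where
  field
    π     : V F → V G
    π-inj : Injective _≡_ _≡_ π
    π-hom : ∀ {a b} → E F a b → E G (π a) (π b)
    π-col : ∀ a → σ (π a) ≡ a
open σSub public

Hits : {F G : Graph} {σ : V G → V F} → Subset (V G) → σSub F G σ → Set
Hits X p = ∃ λ a → T (X (π p a))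

HitsAll : (F G : Graph) (σ : V G → V F) → Subset (V G) → Set
HitsAll F G σ X = (p : σSub F G σ) → Hits X p

preimage : (G H : Graph) → (V G → V H) → Subset (V H) → Subset (V G)
preimage G H σ C v = C (σ v)

restrict : (G H : Graph) (σ : V G → V H) (C : Subset (V H)) →
           V (Induced G (preimage G H σ C)) → V (Induced H C)
restrict G H σ C (v , t) = (σ v , t)

restrictSet : (G H : Graph) (σ : V G → V H) (C : Subset (V H)) →
              Subset (V G) → Subset (V (Induced G (preimage G H σ C)))
restrictSet G H σ C X (v , _) = X v

-- For ⇐, a σ-H-subgraph restricts to a σ-H[C]-subgraph for every C. For ⇒, if every component C
-- had a σ-H[C]-subgraph avoiding X, their union would be a σ-H-subgraph avoiding X, since every edge
-- of H lies in a single component. Finiteness makes reachability and the existence of such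
-- subgraphs decidable, so the case split is constructive and the union can be formed by choosing
-- the subgraph of a canonical representative of each component.
module Submission where

open import Defs
open import Data.Product using (Σ; _×_; ∃; _,_; proj₁; proj₂)
open import Function.Bundles using (_⇔_; mk⇔; Inverse; Injection; Equivalence)

open import Data.Nat using (ℕ; zero; suc; _<_; s≤s)
open import Data.Nat.Properties using (<-≤-trans; ≤-pred)
open import Data.Fin using (Fin; zero; suc)
open import Data.Fin.Properties using (any?; all?; inj⇒≟)
open import Data.Fin.Subset using (_∈_; _⊆_; _-_; ∣_∣; ⊤) renaming (Subset to FinSubset)
open import Data.Fin.Subset.Properties using (_∈?_; ∈⊤; p─q⊆p; ∣p∣≤n; x∈p∧x≢y⇒x∈p-y; x∈p⇒∣p-x∣<∣p∣)
open import Data.Vec.Functional using (Vector; head; tail) renaming (_∷_ to _◂_)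
open import Data.Bool using (Bool; true; false; T)
open import Data.Bool.Properties using (T-irrelevant)
open import Data.Unit using (tt)
open import Data.Sum using (_⊎_; inj₁; inj₂)
open import Relation.Nullary using (¬_; Dec; yes; no; contradiction)
open import Relation.Nullary.Decidable
  using (map′; ¬?; _×-dec_; _→-dec_; isYes; toWitness; fromWitness; decidable-stable; T?)
open import Relation.Unary using (Pred; Decidable)
open import Relation.Binary.Core using (Rel)
open import Relation.Binary.Definitions using (DecidableEquality; _Respects_)
open import Relation.Binary.Structures using (IsEquivalence)
open import Relation.Binary.PropositionalEquality
  using (_≡_; _≗_; refl; sym; trans; cong; subst; subst₂)
open import Function.Base using (_∘_)
open import Level using (0ℓ)
open import Function.Properties.Inverse using (↔⇒↣)
open import Function.Consequences.Propositional using (inverseʳ⇒injective; strictlyInverseʳ⇒inverseʳ)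

module FiniteSearch {A : Set} (fin : Finite A) where
  open Inverse (proj₂ fin) using (to; from; strictlyInverseʳ)

  _≟_ : DecidableEquality A
  _≟_ = inj⇒≟ (↔⇒↣ (proj₂ fin))

  ∃? : {P : Pred A 0ℓ} → Decidable P → Dec (∃ P)
  ∃? {P} P? = map′ (λ (i , p) → from i , p)
                   (λ (x , p) → to x , subst P (sym (strictlyInverseʳ x)) p)
                   (any? (P? ∘ from))

  ∀? : {P : Pred A 0ℓ} → Decidable P → Dec (∀ x → P x)
  ∀? {P} P? = map′ (λ f x → subst P (strictlyInverseʳ x) (f (to x))) (_∘ from)
                   (all? (P? ∘ from))

∃-Vector? : {B : Set} → Finite B → (m : ℕ) {Q : Pred (Vector B m) 0ℓ} →
            Q Respects _≗_ → Decidable Q → Dec (∃ Q)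
∃-Vector? finB zero resp Q? =
  map′ (λ q → _ , q) (λ (f , q) → resp (λ ()) q) (Q? (λ ()))
∃-Vector? finB (suc m) resp Q? =
  map′ (λ (b , f , q) → b ◂ f , q)
       (λ (f , q) → head f , tail f , resp head◂tail q)
       (FiniteSearch.∃? finB λ b →
          ∃-Vector? finB m (λ f≗g → resp (λ { zero → refl ; (suc i) → f≗g i })) (Q? ∘ (b ◂_)))
  where
  head◂tail : ∀ {f : Vector _ (suc m)} → f ≗ head f ◂ tail f
  head◂tail zero = refl
  head◂tail (suc i) = refl

∃-function? : {A B : Set} → Finite A → Finite B → {Q : Pred (A → B) 0ℓ} →
              Q Respects _≗_ → Decidable Q → Dec (∃ Q)
∃-function? (n , ι) finB {Q} resp Q? =
  map′ (λ (f , q) → f ∘ to , q)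
       (λ (f , q) → f ∘ from , resp (λ x → cong f (sym (strictlyInverseʳ x))) q)
       (∃-Vector? finB n (λ f≗g → resp (f≗g ∘ to)) (Q? ∘ (_∘ to)))
  where open Inverse ι using (to; from; strictlyInverseʳ)

least : ∀ {n} {P : Pred (Fin n) 0ℓ} → Decidable P → ∃ P → Fin n
least {suc n} P? w with P? zero | w
... | yes _   | _           = zero
... | no ¬P₀ | (zero , P₀) = contradiction P₀ ¬P₀
... | no _    | (suc i , p) = suc (least (P? ∘ suc) (i , p))

least-satisfies : ∀ {n} {P : Pred (Fin n) 0ℓ} (P? : Decidable P) (w : ∃ P) → P (least P? w)
least-satisfies {suc n} P? w with P? zero | w
... | yes P₀  | _           = P₀
... | no ¬P₀ | (zero , P₀) = contradiction P₀ ¬P₀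
... | no _    | (suc i , p) = least-satisfies (P? ∘ suc) (i , p)

least-cong : ∀ {n} {P Q : Pred (Fin n) 0ℓ} (P? : Decidable P) (Q? : Decidable Q) →
             (∀ i → P i ⇔ Q i) → (v : ∃ P) (w : ∃ Q) → least P? v ≡ least Q? w
least-cong {suc n} P? Q? P⇔Q v w with P? zero | Q? zero | v | w
... | yes _   | yes _   | _           | _           = refl
... | yes P₀  | no ¬Q₀ | _           | _           = contradiction (Equivalence.to (P⇔Q zero) P₀) ¬Q₀
... | no ¬P₀ | yes Q₀  | _           | _           = contradiction (Equivalence.from (P⇔Q zero) Q₀) ¬P₀
... | no ¬P₀ | no _    | (zero , P₀) | _           = contradiction P₀ ¬P₀
... | no _    | no ¬Q₀ | (suc _ , _) | (zero , Q₀) = contradiction Q₀ ¬Q₀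
... | no _    | no _    | (suc i , p) | (suc j , q) =
  cong suc (least-cong (P? ∘ suc) (Q? ∘ suc) (P⇔Q ∘ suc) (i , p) (j , q))

module CanonicalRepresentative {A : Set} (fin : Finite A) {_~_ : Rel A 0ℓ}
                               (_~?_ : ∀ x y → Dec (x ~ y)) (~-equiv : IsEquivalence _~_) where
  open Inverse (proj₂ fin) using (to; from; strictlyInverseʳ)
  open IsEquivalence ~-equiv using () renaming (refl to ~-refl; sym to ~-sym; trans to ~-trans)

  private
    related : ∀ x → ∃ λ i → x ~ from i
    related x = to x , subst (x ~_) (sym (strictlyInverseʳ x)) ~-refl

  rep : A → A
  rep x = from (least (λ i → x ~? from i) (related x))

  rep-~ : ∀ x → x ~ rep x
  rep-~ x = least-satisfies (λ i → x ~? from i) (related x)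

  rep-cong : ∀ {x y} → x ~ y → rep x ≡ rep y
  rep-cong {x} {y} x~y = cong from (least-cong (λ i → x ~? from i) (λ i → y ~? from i)
    (λ i → mk⇔ (~-trans (~-sym x~y)) (~-trans x~y)) (related x) (related y))

Reach-trans : ∀ {G a b c} → Reach G a b → Reach G b c → Reach G a c
Reach-trans here w = w
Reach-trans (step e w) w′ = step e (Reach-trans w w′)

Reach-sym : ∀ {G a b} → Reach G a b → Reach G b a
Reach-sym here = here
Reach-sym {G} (step e w) = Reach-trans (Reach-sym w) (step (E-sym G e) here)

Reach-isEquivalence : (G : Graph) → IsEquivalence (Reach G)
Reach-isEquivalence G = record { refl = here ; sym = Reach-sym ; trans = Reach-trans }

module DecidableReachability (G : Graph) (fin : Finite (V G)) (E? : ∀ a b → Dec (E G a b)) where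
  open FiniteSearch fin using (_≟_; ∃?)
  open Inverse (proj₂ fin) using (to)
  open Injection (↔⇒↣ (proj₂ fin)) using (injective)

  n : ℕ
  n = proj₁ fin

  data WalkIn (A : FinSubset n) : V G → V G → Set where
    here : ∀ {a} → WalkIn A a a
    step : ∀ {a b c} → E G a b → to b ∈ A → WalkIn A b c → WalkIn A a c

  WalkIn⇒Reach : ∀ {A a c} → WalkIn A a c → Reach G a c
  WalkIn⇒Reach here = here
  WalkIn⇒Reach (step e _ w) = step e (WalkIn⇒Reach w)

  WalkIn-mono : ∀ {A B a c} → A ⊆ B → WalkIn A a c → WalkIn B a c
  WalkIn-mono A⊆B here = here
  WalkIn-mono A⊆B (step e b∈A w) = step e (A⊆B b∈A) (WalkIn-mono A⊆B w)

  Reach⇒WalkIn : ∀ {a c} → Reach G a c → WalkIn ⊤ a c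
  Reach⇒WalkIn here = here
  Reach⇒WalkIn (step e w) = step e ∈⊤ (Reach⇒WalkIn w)

  -- Either the walk avoids y, or its part after the last visit to y does.
  avoid-or-restart : ∀ {A x c} y → WalkIn A x c → WalkIn (A - to y) x c ⊎ WalkIn (A - to y) y c
  avoid-or-restart y here = inj₁ here
  avoid-or-restart y (step {b = b} e b∈A w) with avoid-or-restart y w | b ≟ y
  ... | inj₂ w′ | _       = inj₂ w′
  ... | inj₁ w′ | yes refl = inj₂ w′
  ... | inj₁ w′ | no b≢y  = inj₁ (step e (x∈p∧x≢y⇒x∈p-y b∈A (b≢y ∘ injective)) w′)

  walkIn? : (k : ℕ) (A : FinSubset n) → ∣ A ∣ < k → ∀ a c → Dec (WalkIn A a c)
  walkIn? (suc k) A |A|<1+k a c with a ≟ c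
  ... | yes refl = yes here
  ... | no a≢c  = map′ (λ (b , e , b∈A , w) → step e b∈A (WalkIn-mono (p─q⊆p A _) w)) firstStep
                       (∃? λ b → E? a b ×-dec continue b)
    where
    continue : ∀ b → Dec (to b ∈ A × WalkIn (A - to b) b c)
    continue b with to b ∈? A
    ... | no b∉A = no (b∉A ∘ proj₁)
    ... | yes b∈A = map′ (b∈A ,_) proj₂
                         (walkIn? k (A - to b) (<-≤-trans (x∈p⇒∣p-x∣<∣p∣ b∈A) (≤-pred |A|<1+k)) b c)

    firstStep : WalkIn A a c → ∃ λ b → E G a b × to b ∈ A × WalkIn (A - to b) b c
    firstStep here = contradiction refl a≢c
    firstStep (step {b = b} e b∈A w) with avoid-or-restart b w
    ... | inj₁ w′ = b , e , b∈A , w′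
    ... | inj₂ w′ = b , e , b∈A , w′

  Reach? : ∀ a c → Dec (Reach G a c)
  Reach? a c = map′ WalkIn⇒Reach Reach⇒WalkIn (walkIn? (suc n) ⊤ (s≤s (∣p∣≤n ⊤)) a c)

Induced-≡ : ∀ {G P} {u w : V (Induced G P)} → proj₁ u ≡ proj₁ w → u ≡ w
Induced-≡ {u = a , s} {w = .a , t} refl = cong (a ,_) (T-irrelevant s t)

mkσSub : ∀ {F K τ} (π : V F → V K) → (∀ {a b} → E F a b → E K (π a) (π b)) →
         (∀ a → τ (π a) ≡ a) → σSub F K τ
mkσSub {τ = τ} π hom col = record
  { π = π
  ; π-inj = inverseʳ⇒injective π (strictlyInverseʳ⇒inverseʳ {f⁻¹ = τ} π col)
  ; π-hom = hom
  ; π-col = col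
  }

choose : {B : Set} (b : Bool) → (T b → B) → B → B
choose true  f d = f tt
choose false f d = d

choose-T : {B : Set} (b : Bool) (f : T b → B) (d : B) (t : T b) → choose b f d ≡ f t
choose-T true f d tt = refl

T-Σ? : (b : Bool) {Q : T b → Set} → ((t : T b) → Dec (Q t)) → Dec (Σ (T b) Q)
T-Σ? true  Q? = map′ (tt ,_) proj₂ (Q? tt)
T-Σ? false Q? = no λ ()

module Copies (H G : Graph) (σ : V G → V H) (X : Subset (V G)) where

  H[_] : Subset (V H) → Graph
  H[ C ] = Induced H C

  G[_] : Subset (V H) → Graph
  G[ C ] = Induced G (preimage G H σ C)

  σSubOn : Subset (V H) → Set
  σSubOn C = σSub H[ C ] G[ C ] (restrict G H σ C)

  HitsOn : (C : Subset (V H)) → σSubOn C → Set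
  HitsOn C = Hits (restrictSet G H σ C X)

  HitsAllOn : Subset (V H) → Set
  HitsAllOn C = HitsAll H[ C ] G[ C ] (restrict G H σ C) (restrictSet G H σ C X)

  restrictσSub : ∀ C → σSub H G σ → σSubOn C
  restrictσSub C p = mkσSub πC (π-hom p) (λ (a , _) → Induced-≡ {G = H} (π-col p a))
    where
    πC : V H[ C ] → V G[ C ]
    πC (a , t) = π p a , subst (T ∘ C) (sym (π-col p a)) t

  HitsAllOn⇒HitsAll : ∀ C → HitsAllOn C → HitsAll H G σ X
  HitsAllOn⇒HitsAll C hitsAll p with hitsAll (restrictσSub C p)
  ... | (a , _) , x = a , x

  -- Total maps, so that they can be searched for; their values outside C are irrelevant.
  record AvoidingCopyOn (C : Subset (V H)) (π : V H → V G) : Set where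
    field
      colour : ∀ a → T (C a) → σ (π a) ≡ a
      avoids : ∀ a → T (C a) → ¬ T (X (π a))
      hom    : ∀ a b → T (C a) → T (C b) → E H a b → E G (π a) (π b)
  open AvoidingCopyOn

  AvoidingCopyOn-resp : ∀ C → AvoidingCopyOn C Respects _≗_
  AvoidingCopyOn-resp C π≗ρ copy = record
    { colour = λ a t → subst (λ v → σ v ≡ a) (π≗ρ a) (colour copy a t)
    ; avoids = λ a t → subst (¬_ ∘ T ∘ X) (π≗ρ a) (avoids copy a t)
    ; hom    = λ a b s t e → subst₂ (E G) (π≗ρ a) (π≗ρ b) (hom copy a b s t e)
    }

  unhit⇒AvoidingCopyOn : ∀ {C c} → T (C c) → (p : σSubOn C) → ¬ HitsOn C p → ∃ (AvoidingCopyOn C)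
  unhit⇒AvoidingCopyOn {C} {c} c∈C p unhit = π̂ , record
    { colour = λ a t → trans (cong σ (π̂-≡ a t)) (cong proj₁ (π-col p (a , t)))
    ; avoids = λ a t x → unhit ((a , t) , subst (T ∘ X) (π̂-≡ a t) x)
    ; hom    = λ a b s t e → subst₂ (E G) (sym (π̂-≡ a s)) (sym (π̂-≡ b t)) (π-hom p e)
    }
    where
    πC : ∀ a → T (C a) → V G
    πC a t = proj₁ (π p (a , t))
    π̂ : V H → V G
    π̂ a = choose (C a) (πC a) (πC c c∈C)
    π̂-≡ : ∀ a (t : T (C a)) → π̂ a ≡ πC a t
    π̂-≡ a = choose-T (C a) (πC a) (πC c c∈C)

  module OnFiniteGraphs (finH : Finite (V H)) (E?H : ∀ a b → Dec (E H a b))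
                        (finG : Finite (V G)) (E?G : ∀ a b → Dec (E G a b)) where
    open FiniteSearch finH using (_≟_; ∃?; ∀?)
    open DecidableReachability H finH E?H using (Reach?)
    open CanonicalRepresentative finH Reach? (Reach-isEquivalence H) using (rep; rep-~; rep-cong)

    avoidingCopyOn? : ∀ C π → Dec (AvoidingCopyOn C π)
    avoidingCopyOn? C π =
      map′ (λ (col , avo , hom) → record { colour = col ; avoids = avo ; hom = hom })
           (λ copy → colour copy , avoids copy , hom copy)
           (∀? (λ a → T? (C a) →-dec σ (π a) ≟ a) ×-dec
            ∀? (λ a → T? (C a) →-dec ¬? (T? (X (π a)))) ×-dec
            ∀? (λ a → ∀? λ b → T? (C a) →-dec T? (C b) →-dec E?H a b →-dec E?G (π a) (π b)))

    ∃-avoidingCopyOn? : ∀ C → Dec (∃ (AvoidingCopyOn C))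
    ∃-avoidingCopyOn? C = ∃-function? finH finG (AvoidingCopyOn-resp C) (avoidingCopyOn? C)

    hitsOn? : ∀ C (p : σSubOn C) → Dec (HitsOn C p)
    hitsOn? C p = map′ (λ (a , t , x) → (a , t) , x) (λ ((a , t) , x) → a , t , x)
                       (∃? λ a → T-Σ? (C a) λ t → T? (X (proj₁ (π p (a , t)))))

    component : V H → Subset (V H)
    component c a = isYes (Reach? a c)

    component-IsComponent : ∀ c → IsComponent H (component c)
    component-IsComponent c = c , λ a → mk⇔ toWitness fromWitness

    -- Each vertex is mapped by the copy of its component's canonical representative, so the
    -- two ends of an edge are mapped by the same copy.
    glue : (∀ c → ∃ (AvoidingCopyOn (component c))) → Σ (σSub H G σ) (¬_ ∘ Hits X)
    glue copy = mkσSub π̂ π̂-hom π̂-colour , λ (a , x) → avoids (proj₂ (copy (rep a))) a (in-own a) x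
      where
      π̂ : V H → V G
      π̂ a = proj₁ (copy (rep a)) a

      in-own : ∀ a → T (component (rep a) a)
      in-own a = fromWitness (rep-~ a)

      π̂-colour : ∀ a → σ (π̂ a) ≡ a
      π̂-colour a = colour (proj₂ (copy (rep a))) a (in-own a)

      same-copy-hom : ∀ {r r′ a b} → r ≡ r′ → T (component r a) → T (component r′ b) → E H a b →
                      E G (proj₁ (copy r) a) (proj₁ (copy r′) b)
      same-copy-hom {r} {a = a} {b} refl = hom (proj₂ (copy r)) a b

      π̂-hom : ∀ {a b} → E H a b → E G (π̂ a) (π̂ b)
      π̂-hom {a} {b} e = same-copy-hom (rep-cong (step e here)) (in-own a) (in-own b) e

    HitsAll⇒HitsAllOn-component : HitsAll H G σ X → ∃ λ c → HitsAllOn (component c)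
    HitsAll⇒HitsAllOn-component hitsAll with ∃? (λ c → ¬? (∃-avoidingCopyOn? (component c)))
    ... | yes (c , noCopy) = c , λ p → decidable-stable (hitsOn? (component c) p)
                                         (noCopy ∘ unhit⇒AvoidingCopyOn (fromWitness here) p)
    ... | no ¬noCopy
      with glue (λ c → decidable-stable (∃-avoidingCopyOn? (component c)) (¬noCopy ∘ (c ,_)))
    ...   | p , unhit = contradiction (hitsAll p) unhit

lemma13 : (H G : Graph) → IsFinGraph H → IsFinGraph G →
          (σ : V G → V H) (X : Subset (V G)) →
          HitsAll H G σ X ⇔
            Σ (Subset (V H)) (λ C → IsComponent H C ×
              HitsAll (Induced H C) (Induced G (preimage G H σ C))
                      (restrict G H σ C) (restrictSet G H σ C X))
lemma13 H G (finH , E?H) (finG , E?G) σ X =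
  mk⇔ (λ hitsAll → let c , hitsOn = HitsAll⇒HitsAllOn-component hitsAll
                   in component c , component-IsComponent c , hitsOn)
      (λ (C , _ , hitsOn) → HitsAllOn⇒HitsAll C hitsOn)
  where
  open Copies H G σ X
  open OnFiniteGraphs finH E?H finG E?G
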